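{- Let $t\geq 3$ and let $\boldsymbol{R}=(R^0,R^1,\ldots,R^{2t-1},R^0)$ be the symmetric $2t$-cycle in the hypercube graph $\boldsymbol{H}(t,2)$ given by $R^0=\mathrm{T}^{(+)}$, $R^s={}_{ -[s]}R^0$ for $1\leq s\leq t-1$, and $R^{k+t}=-R^k$ for $0\leq k\leq t-1$. Let $A$ be a nonempty subset of $E_t=\{1,\ldots,t\}$, and let $A=[i_1,j_1]\,\dot\cup\,[i_2,j_2]\,\dot\cup\cdots\dot\cup\,[i_{\varrho},j_{\varrho}]$ be its partition into intervals $[i_k,j_k]=\{i_k,i_k+1,\ldots,j_k\}$ (with $i_k\leq j_k$) such that $j_1+2\leq i_2,\ j_2+2\leq i_3,\ \ldots,\ j_{\varrho-1}+2\leq i_{\varrho}$, for some $\varrho=\varrho(A)$. Then: \begin{itemize} \item[(i)] If $\{1,t\}\cap A=\{1\}$, then $|\boldsymbol{Q}({}_{ -A}\mathrm{T}^{(+)},\boldsymbol{R})|=2\varrho-1$ and $\boldsymbol{x}({}_{ -A}\mathrm{T}^{(+)},\boldsymbol{R})=\sum_{1\leq k\leq\varrho}\boldsymbol{\sigma}(j_k+1)-\sum_{2\leq \ell\leq\varrho}\boldsymbol{\sigma}(i_{\ell})$. \item[(ii)] If $\{1,t\}\cap A=\{1,t\}$, then $|\boldsymbol{Q}({}_{ -A}\mathrm{T}^{(+)},\boldsymbol{R})|=2\varrho-1$ and $\boldsymbol{x}({}_{ -A}\mathrm{T}^{(+)},\boldsymbol{R})=\sum_{1\leq k\leq\varrho-1}\boldsymbol{\sigma}(j_k+1)-\sum_{1\leq\ell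 \leq\varrho}\boldsymbol{\sigma}(i_{\ell})$. \item[(iii)] If $\{1,t\}\cap A=\emptyset$, then $|\boldsymbol{Q}({}_{ -A}\mathrm{T}^{(+)},\boldsymbol{R})|=2\varrho+1$ and $\boldsymbol{x}({}_{ -A}\mathrm{T}^{(+)},\boldsymbol{R})=\boldsymbol{\sigma}(1)+\sum_{1\leq k\leq\varrho}\boldsymbol{\sigma}(j_k+1)-\sum_{1\leq\ell \leq\varrho}\boldsymbol{\sigma}(i_{\ell})$. \item[(iv)] If $\{1,t\}\cap A=\{t\}$, then $|\boldsymbol{Q}({}_{ -A}\mathrm{T}^{(+)},\boldsymbol{R})|=2\varrho-1$ and $\boldsymbol{x}({}_{ -A}\mathrm{T}^{(+)},\boldsymbol{R})=\sum_{1\leq k\leq\varrho-1}\boldsymbol{\sigma}(j_k+1)-\sum_{1\leq \ell\leq\varrho}\boldsymbol{\sigma}(i_{\ell})$. \end{itemize}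
   Context: Let $t\geq 3$ be an integer and $E_t=[t]=\{1,\ldots,t\}$; for integers $a\leq b$, $[a,b]=\{a,a+1,\ldots,b\}$. The hypercube graph $\boldsymbol{H}(t,2)$ has vertex set $\{1,-1\}^t$ (called topes), consisting of row vectors $T=(T(1),\ldots,T(t))\in\mathbb{R}^t$; two vertices are adjacent iff they differ in exactly one coordinate. $\mathrm{T}^{(+)}=(1,\ldots,1)$. For $T\in\{1,-1\}^t$ and $A\subseteq E_t$, ${}_{ -A}T$ is the tope obtained from $T$ by changing the sign of every coordinate $T(e)$ with $e\in A$ and leaving the other coordinates unchanged. $\boldsymbol{\sigma}(s)$ denotes the $s$-th standard basis row vector of $\mathbb{R}^t$. Let $\mathbf{M}$ be the $t\times t$ real matrix whose rows, from top to bottom, are $R^0,R^1,\ldots,R^{t-1}$ (it is nonsingular). For a tope $T$ define the row vector $\boldsymbol{x}(T,\boldsymbol{R})=T\mathbf{M}^{ -1}$; its entries lie in $\{ -1,0,1\}$. $\boldsymbol{Q}(T,\boldsymbol{R})$ denotes the unique inclusion-minimal subset of the vertex set of the cycle $\boldsymbol{R}$ whose sum equals $T$ (it is known to exist and be unique); with $\boldsymbol{x}=\boldsymbol{x}(T,\boldsymbol{R})=(x_1,\ldots,x_t)$ one has $\boldsymbol{Q}(T,\boldsymbol{R})=\{x_i\cdot R^{i-1}\colon x_i\neq 0\}$, so $|\boldsymbol{Q}(T,\boldsymbol{R})|$ is the number of nonzero entries of $\boldsymbol{x}(T,\boldsymbol{R})$. -}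

module Defs where

open import Data.Nat as ℕ using (ℕ; zero; suc; _≤_; _<_; _≤?_; _∸_)
open import Data.Integer as ℤ using (ℤ; +_; -_; _*_; _+_)
open import Data.Fin using (Fin; toℕ)
open import Data.Fin.Subset using (Subset; _∈_)
open import Data.Vec using (lookup)
open import Data.Bool using (true; false; if_then_else_)
open import Data.List using (List; length; filter; allFin; upTo; map; foldr)
open import Data.Product using (Σ; _×_; ∃)
open import Relation.Binary.PropositionalEquality using (_≡_)
open import Relation.Nullary using (¬_; ¬?; does)
open import Function.Bundles using (_⇔_)

-- Row vectors in ℤ^t; coordinate e : Fin t stands for the 1-based coordinate toℕ e + 1.
Vecℤ : ℕ → Set
Vecℤ t = Fin t → ℤ

idx : {t : ℕ} → Fin t → ℕ
idx e = suc (toℕ e)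

0v : {t : ℕ} → Vecℤ t
0v _ = + 0

_⊕_ : {t : ℕ} → Vecℤ t → Vecℤ t → Vecℤ t
(u ⊕ v) e = u e + v e

_⊖_ : {t : ℕ} → Vecℤ t → Vecℤ t → Vecℤ t
(u ⊖ v) e = u e + (- v e)

negV : {t : ℕ} → Vecℤ t → Vecℤ t
negV u e = - u e

_≗v_ : {t : ℕ} → Vecℤ t → Vecℤ t → Set
u ≗v v = ∀ e → u e ≡ v e

T⁺ : (t : ℕ) → Vecℤ t
T⁺ t _ = + 1

σ : {t : ℕ} → ℕ → Vecℤ t
σ s e = if does (idx e ℕ.≟ s) then + 1 else + 0

flipA : {t : ℕ} → Subset t → Vecℤ t → Vecℤ t
flipA A T e = if lookup A e then - T e else T e

_∈ₙ_ : {t : ℕ} → ℕ → Subset t → Set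
_∈ₙ_ {t} n A = Σ (Fin t) λ e → idx e ≡ n × e ∈ A

-- The symmetric 2t-cycle R: R^0 = T^(+), R^s = _{-[s]} R^0 (1 ≤ s ≤ t-1),
-- R^{k+t} = - R^k (0 ≤ k ≤ t-1).  (Indices ≥ 2t are irrelevant.)
R : (t : ℕ) → ℕ → Vecℤ t
R t s with s ℕ.<? t
... | Relation.Nullary.yes _ = λ e → if does (idx e ≤? s) then - (+ 1) else + 1
... | Relation.Nullary.no _  = λ e → - (if does (idx e ≤? (s ∸ t)) then - (+ 1) else + 1)

sumV : {t : ℕ} → List (Vecℤ t) → Vecℤ t
sumV = foldr _⊕_ 0v

range : ℕ → ℕ → List ℕ
range a b = map (a ℕ.+_) (upTo (suc b ∸ a))

ΣV[_,_] : {t : ℕ} → ℕ → ℕ → (ℕ → Vecℤ t) → Vecℤ t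
ΣV[ a , b ] f = sumV (map f (range a b))

-- x M, where M is the t×t matrix with rows R^0, …, R^{t-1}:
-- (x M)(e) = Σ_{i} x_i R^{i-1}(e)   (x_i ↔ Fin index i-1)
xM : {t : ℕ} → Vecℤ t → Vecℤ t
xM {t} x e = foldr _+_ (+ 0) (map (λ i → x i * R t (toℕ i) e) (allFin t))

-- "x(T,R) = v", i.e. v = T M⁻¹: v M = T, and v is the unique such vector.
IsXOf : {t : ℕ} → Vecℤ t → Vecℤ t → Set
IsXOf {t} T v = (xM v ≗v T) × (∀ (y : Vecℤ t) → xM y ≗v T → y ≗v v)

-- number of nonzero entries (= |Q(T,R)| when v = x(T,R))
nnz : {t : ℕ} → Vecℤ t → ℕ
nnz {t} v = length (filter (λ e → ¬? (v e ℤ.≟ + 0)) (allFin t))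

IntervalPartition : (t : ℕ) → Subset t → (ϱ : ℕ) → (i j : ℕ → ℕ) → Set
IntervalPartition t A ϱ i j =
  (∀ k → 1 ≤ k → k ≤ ϱ → (1 ≤ i k) × (i k ≤ j k) × (j k ≤ t))
  × (∀ k → 1 ≤ k → k < ϱ → j k ℕ.+ 2 ≤ i (suc k))
  × (∀ n → (n ∈ₙ A) ⇔ (∃ λ k → (1 ≤ k) × (k ≤ ϱ) × (i k ≤ n) × (n ≤ j k)))

-- Write col w n for the n-th coordinate of w M, i.e. ∑_i w_i R^i(n), where R^i(n) = -1 iff n ≤ i.
--  1. M is nonsingular: col w n - col w (n+1) = -2 w_n and col w 0 = - col w t, so w M = 0
--     forces w = 0.  Hence any v with v M = T is x(T, R) (isX).
--  2. For an interval [a, b] ⊆ [1, t] the vector σ(b+1) - σ(a) is mapped to -2 on [a, b] and 0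
--     elsewhere, plus 1 everywhere when b = t (interval-value).  Summed over the blocks
--     [i_k, j_k] of A this gives [t ∈ A] - 2 [n ∈ A] (blocks-value), while _{-A}T⁺ is
--     1 - 2 [n ∈ A].  Each candidate vector of the theorem differs from the block sum by one
--     basis vector whose image c₀ satisfies c₀ + [t ∈ A] = 1: +σ(i_1) = +σ(1) in case (i),
--     the added σ(1) in case (iii), and -σ(j_ϱ + 1) = -σ(t + 1) = 0 in cases (ii) and (iv).
--  3. Each candidate is a signed sum of distinct basis vectors σ(s), s ∈ [1, t], so its number
--     of nonzero entries is its number of terms (nnz-signed), namely 2ϱ - 1 or 2ϱ + 1.
-- The file develops finite counting, the matrix M, blocks (the intervals reindexed by Fin ϱ),
-- then the three cases; cases (ii) and (iv) share one proof.
module Submission where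

open import Defs
open import Data.Nat using (ℕ; suc; _≤_; _*_; _∸_; _+_)
open import Data.Fin.Subset using (Subset)
open import Data.Product using (_×_; ∃)
open import Relation.Binary.PropositionalEquality using (_≡_)
open import Relation.Nullary using (¬_)

open import Data.Nat using (zero; _<_; z≤n; s≤s; _≤?_; _<?_)
import Data.Nat as ℕ
import Data.Nat.Properties as ℕP
open import Data.Integer using (ℤ; +_; -_) renaming (_+_ to _+ᶻ_; _-_ to _-ᶻ_; _*_ to _*ᶻ_)
import Data.Integer as ℤ
import Data.Integer.Properties as ℤP
open import Data.Integer.Tactic.RingSolver using (solve-∀)
import Data.Nat.Tactic.RingSolver as NatSolver
open import Data.Fin as Fin using (Fin; toℕ)
import Data.Fin.Properties as FinP
open import Data.Sum using (inj₁; inj₂)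
open import Data.Bool using (Bool; true; false; if_then_else_)
open import Data.Vec using (lookup)
import Data.Vec.Properties as VecP
import Data.Vec.Functional as VecF
open import Data.List using (map; foldr; filter; length; tabulate; applyUpTo)
open import Data.Product using (_,_; proj₁; proj₂)
open import Data.Empty using (⊥; ⊥-elim)
open import Relation.Binary using (tri<; tri≈; tri>)
open import Relation.Binary.PropositionalEquality
  using (refl; sym; trans; cong; cong₂; subst; _≢_; module ≡-Reasoning)
open import Relation.Nullary using (does; yes; no; ¬?; _×-dec_)
open import Relation.Nullary.Decidable using (dec-true; dec-false)
open import Relation.Unary using (Pred; Decidable)
open import Level using (0ℓ)
open import Function using (_∘_; case_of_)
open import Function.Definitions using (Injective)
open import Function.Bundles using (_⇔_; mk⇔; Equivalence)
import Algebra.Properties.Semiring.Sum as SemiringSum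

module ℤΣ = SemiringSum ℤP.+-*-semiring
module ℕΣ = SemiringSum ℕP.+-*-semiring
open ℤΣ using () renaming (sum to ∑ᶻ)
open ℕΣ using () renaming (sum to ∑ⁿ)

𝟙 : Bool → ℕ
𝟙 b = if b then 1 else 0

count : {n : ℕ} {P : Pred (Fin n) 0ℓ} → Decidable P → ℕ
count P? = ∑ⁿ (λ k → 𝟙 (does (P? k)))

count-none : ∀ {n} {P : Pred (Fin n) 0ℓ} (P? : Decidable P) → (∀ k → ¬ P k) → count P? ≡ 0
count-none {zero}  P? none = refl
count-none {suc n} P? none with P? Fin.zero
... | yes p = ⊥-elim (none Fin.zero p)
... | no _  = count-none (P? ∘ Fin.suc) (none ∘ Fin.suc)

AtMostOne : ∀ {n} → Pred (Fin n) 0ℓ → Set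
AtMostOne P = ∀ {k l} → P k → P l → k ≡ l

count-≤1 : ∀ {n} {P : Pred (Fin n) 0ℓ} (P? : Decidable P) → AtMostOne P → count P? ≤ 1
count-≤1 {zero}  P? uniq = z≤n
count-≤1 {suc n} P? uniq with P? Fin.zero
... | yes p rewrite count-none (P? ∘ Fin.suc) (λ k pk → FinP.0≢1+n (uniq p pk)) = s≤s z≤n
... | no _  = count-≤1 (P? ∘ Fin.suc) (λ pk pl → FinP.suc-injective (uniq pk pl))

count-≥1 : ∀ {n} {P : Pred (Fin n) 0ℓ} (P? : Decidable P) {k : Fin n} → P k → 1 ≤ count P?
count-≥1 P? {Fin.zero} p with P? Fin.zero
... | yes _  = s≤s z≤n
... | no ¬p  = ⊥-elim (¬p p)
count-≥1 P? {Fin.suc k} p =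
  ℕP.≤-trans (count-≥1 (P? ∘ Fin.suc) p) (ℕP.m≤n+m _ (𝟙 (does (P? Fin.zero))))

count-one : ∀ {n} {P : Pred (Fin n) 0ℓ} (P? : Decidable P) {k : Fin n} → P k → AtMostOne P →
            count P? ≡ 1
count-one P? p uniq = ℕP.≤-antisym (count-≤1 P? uniq) (count-≥1 P? p)

count-witness : ∀ {n} {P : Pred (Fin n) 0ℓ} (P? : Decidable P) → 1 ≤ count P? → ∃ P
count-witness {zero}  P? ()
count-witness {suc n} P? pos with P? Fin.zero
... | yes p = Fin.zero , p
... | no _  with count-witness (P? ∘ Fin.suc) pos
...   | k , p = Fin.suc k , p

∑-one : ∀ n → ∑ⁿ {n} (λ _ → 1) ≡ n
∑-one zero    = refl
∑-one (suc n) = cong suc (∑-one n)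

∑-pos : ∀ {n} (f : Fin n → ℕ) → + ∑ⁿ f ≡ ∑ᶻ (λ k → + f k)
∑-pos {zero}  f = refl
∑-pos {suc n} f = trans (ℤP.pos-+ (f Fin.zero) _) (cong (+ f Fin.zero +ᶻ_) (∑-pos (f ∘ Fin.suc)))

∑-minus : ∀ {n} (f g : Fin n → ℤ) → ∑ᶻ (λ k → f k -ᶻ g k) ≡ ∑ᶻ f -ᶻ ∑ᶻ g
∑-minus {zero}  f g = refl
∑-minus {suc n} f g =
  trans (cong ((f Fin.zero -ᶻ g Fin.zero) +ᶻ_) (∑-minus (f ∘ Fin.suc) (g ∘ Fin.suc)))
        (regroup (f Fin.zero) (g Fin.zero) (∑ᶻ (f ∘ Fin.suc)) (∑ᶻ (g ∘ Fin.suc)))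
  where
  regroup : ∀ a b c d → (a -ᶻ b) +ᶻ (c -ᶻ d) ≡ (a +ᶻ c) -ᶻ (b +ᶻ d)
  regroup = solve-∀

foldr-tabulate : ∀ {A : Set} {n} (g : Fin n → A) (f : A → ℤ) →
                 foldr _+ᶻ_ (+ 0) (map f (tabulate g)) ≡ ∑ᶻ (f ∘ g)
foldr-tabulate {n = zero}  g f = refl
foldr-tabulate {n = suc n} g f = cong (f (g Fin.zero) +ᶻ_) (foldr-tabulate (g ∘ Fin.suc) f)

length-filter-tabulate : ∀ {A : Set} {P : Pred A 0ℓ} (P? : Decidable P) {n} (g : Fin n → A) →
                         length (filter P? (tabulate g)) ≡ count (P? ∘ g)
length-filter-tabulate P? {zero}  g = refl
length-filter-tabulate P? {suc n} g with does (P? (g Fin.zero))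
... | true  = cong suc (length-filter-tabulate P? (g ∘ Fin.suc))
... | false = length-filter-tabulate P? (g ∘ Fin.suc)

ΣV-coord : ∀ {t} (F : ℕ → Vecℤ t) a b (e : Fin t) →
           ΣV[ a , b ] F e ≡ ∑ᶻ {suc b ∸ a} (λ k → F (a + toℕ k) e)
ΣV-coord F a b e = go (suc b ∸ a) (λ x → x)
  where
  go : ∀ n (g : ℕ → ℕ) →
       sumV (map F (map (λ x → a + x) (applyUpTo g n))) e ≡ ∑ᶻ {n} (λ k → F (a + g (toℕ k)) e)
  go zero    g = refl
  go (suc n) g = cong (F (a + g 0) e +ᶻ_) (go n (g ∘ suc))

nnz-count : ∀ {t} (v : Vecℤ t) → nnz v ≡ count (λ e → ¬? (v e ℤ.≟ + 0))
nnz-count {t} v = length-filter-tabulate (λ e → ¬? (v e ℤ.≟ + 0)) (λ e → e)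

nnz-cong : ∀ {t} {u v : Vecℤ t} → u ≗v v → nnz u ≡ nnz v
nnz-cong {u = u} {v} u≗v = begin
  nnz u                                         ≡⟨ nnz-count u ⟩
  count (λ e → ¬? (u e ℤ.≟ + 0))
    ≡⟨ ℕΣ.sum-cong-≗ (λ e → cong (λ x → 𝟙 (does (¬? (x ℤ.≟ + 0)))) (u≗v e)) ⟩
  count (λ e → ¬? (v e ℤ.≟ + 0))                ≡⟨ sym (nnz-count v) ⟩
  nnz v                                         ∎
  where open ≡-Reasoning

δ : ℕ → ℕ → ℕ
δ x y = 𝟙 (does (x ℕ.≟ y))

σ-δ : ∀ {t} s (e : Fin t) → σ s e ≡ + δ (idx e) s
σ-δ s e with does (idx e ℕ.≟ s)
... | true  = refl
... | false = refl

δ-refl : ∀ x → δ x x ≡ 1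
δ-refl x rewrite dec-true (x ℕ.≟ x) refl = refl

δ-≢ : ∀ {x y} → x ≢ y → δ x y ≡ 0
δ-≢ {x} {y} x≢y rewrite dec-false (x ℕ.≟ y) x≢y = refl

index-hit-once : ∀ {t s} → 1 ≤ s → s ≤ t → count {t} (λ e → idx e ℕ.≟ s) ≡ 1
index-hit-once {t} {suc s} _ s≤t =
  count-one (λ e → idx e ℕ.≟ suc s) (cong suc (FinP.toℕ-fromℕ< s≤t))
            (λ p q → FinP.toℕ-injective (ℕP.suc-injective (trans p (sym q))))

InRange : ∀ {n} → ℕ → (Fin n → ℕ) → Set
InRange t p = ∀ k → 1 ≤ p k × p k ≤ t

mult : ∀ {n} → ℕ → (Fin n → ℕ) → ℕ
mult x p = count (λ k → x ℕ.≟ p k)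

mult-≤1 : ∀ {n} {p : Fin n → ℕ} x → Injective _≡_ _≡_ p → mult x p ≤ 1
mult-≤1 x inj = count-≤1 (λ k → x ℕ.≟ _) (λ x≡pk x≡pl → inj (trans (sym x≡pk) x≡pl))

∑-mult : ∀ {t n} (p : Fin n → ℕ) → InRange t p → ∑ⁿ {t} (λ e → mult (idx e) p) ≡ n
∑-mult {t} {n} p range = begin
  ∑ⁿ {t} (λ e → ∑ⁿ {n} (λ k → δ (idx e) (p k)))
    ≡⟨ ℕΣ.∑-comm {t} {n} (λ e k → δ (idx e) (p k)) ⟩
  ∑ⁿ {n} (λ k → count {t} (λ e → idx e ℕ.≟ p k))
    ≡⟨ ℕΣ.sum-cong-≗ (λ k → index-hit-once (proj₁ (range k)) (proj₂ (range k))) ⟩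
  ∑ⁿ {n} (λ _ → 1)
    ≡⟨ ∑-one n ⟩
  n ∎
  where open ≡-Reasoning

basisSum : ∀ {t n} → (Fin n → ℕ) → Vecℤ t
basisSum p e = ∑ᶻ (λ k → σ (p k) e)

basisSum-coord : ∀ {t n} (p : Fin n → ℕ) (e : Fin t) → basisSum p e ≡ + mult (idx e) p
basisSum-coord p e = trans (ℤΣ.sum-cong-≗ (λ k → σ-δ (p k) e)) (sym (∑-pos (λ k → δ (idx e) (p k))))

nonzero-indicator : ∀ P M → P ≤ 1 → M ≤ 1 → ¬ (1 ≤ P × 1 ≤ M) →
                    𝟙 (does (¬? ((+ P -ᶻ + M) ℤ.≟ + 0))) ≡ P + M
nonzero-indicator 0 0 _ _ _ = refl
nonzero-indicator 1 0 _ _ _ = refl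
nonzero-indicator 0 1 _ _ _ = refl
nonzero-indicator 1 1 _ _ both = ⊥-elim (both (s≤s z≤n , s≤s z≤n))
nonzero-indicator (suc (suc _)) _ (s≤s ()) _ _
nonzero-indicator _ (suc (suc _)) _ (s≤s ()) _

nnz-signed : ∀ {t a b} (p : Fin a → ℕ) (m : Fin b → ℕ) →
             Injective _≡_ _≡_ p → Injective _≡_ _≡_ m → (∀ k l → p k ≢ m l) →
             InRange t p → InRange t m → nnz {t} (basisSum p ⊖ basisSum m) ≡ a + b
nnz-signed {t} {a} {b} p m p-inj m-inj p≢m p-range m-range = begin
  nnz {t} (basisSum p ⊖ basisSum m)                  ≡⟨ nnz-count {t} (basisSum p ⊖ basisSum m) ⟩
  ∑ⁿ {t} (λ e → 𝟙 (does (¬? ((basisSum p ⊖ basisSum m) e ℤ.≟ + 0))))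
    ≡⟨ ℕΣ.sum-cong-≗ {t} nonzero ⟩
  ∑ⁿ {t} (λ e → mult (idx e) p + mult (idx e) m)        ≡⟨ ℕΣ.∑-distrib-+ {t} (λ e → mult (idx e) p) _ ⟩
  ∑ⁿ {t} (λ e → mult (idx e) p) + ∑ⁿ {t} (λ e → mult (idx e) m)
    ≡⟨ cong₂ _+_ (∑-mult p p-range) (∑-mult m m-range) ⟩
  a + b                                              ∎
  where
  open ≡-Reasoning
  disjoint : ∀ x → ¬ (1 ≤ mult x p × 1 ≤ mult x m)
  disjoint x (inP , inM) with count-witness (λ k → x ℕ.≟ p k) inP | count-witness (λ l → x ℕ.≟ m l) inM
  ... | k , x≡pk | l , x≡ml = p≢m k l (trans (sym x≡pk) x≡ml)
  nonzero : ∀ e → 𝟙 (does (¬? ((basisSum p ⊖ basisSum m) e ℤ.≟ + 0))) ≡ mult (idx e) p + mult (idx e) m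
  nonzero e rewrite basisSum-coord p e | basisSum-coord m e =
    nonzero-indicator _ _ (mult-≤1 (idx e) p-inj) (mult-≤1 (idx e) m-inj) (disjoint (idx e))

ρ : ℕ → ℕ → ℤ
ρ n s = if does (n ≤? s) then - (+ 1) else + 1

ρ-≤ : ∀ {n s} → n ≤ s → ρ n s ≡ - (+ 1)
ρ-≤ {n} {s} n≤s rewrite dec-true (n ≤? s) n≤s = refl

ρ-> : ∀ {n s} → s < n → ρ n s ≡ + 1
ρ-> {n} {s} s<n rewrite dec-false (n ≤? s) (ℕP.<⇒≱ s<n) = refl

R-coord : ∀ t s (e : Fin t) → s < t → R t s e ≡ ρ (idx e) s
R-coord t s e s<t with s <? t
... | yes _   = refl
... | no s≮t = ⊥-elim (s≮t s<t)

-- col w n = ∑_i w_i R^i(n), i.e. the n-th coordinate of w M, extended to every n ∈ ℕ.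
col : ∀ {t} → Vecℤ t → ℕ → ℤ
col w n = ∑ᶻ (λ i → w i *ᶻ ρ n (toℕ i))

xM-col : ∀ {t} (w : Vecℤ t) e → xM w e ≡ col w (idx e)
xM-col {t} w e = trans (foldr-tabulate (λ i → i) (λ i → w i *ᶻ R t (toℕ i) e))
                       (ℤΣ.sum-cong-≗ (λ i → cong (w i *ᶻ_) (R-coord t (toℕ i) e (FinP.toℕ<n i))))

col-cong : ∀ {t} {u v : Vecℤ t} n → u ≗v v → col u n ≡ col v n
col-cong n u≗v = ℤΣ.sum-cong-≗ (λ i → cong (_*ᶻ ρ n (toℕ i)) (u≗v i))

col-⊕ : ∀ {t} (u v : Vecℤ t) n → col (u ⊕ v) n ≡ col u n +ᶻ col v n
col-⊕ u v n = trans (ℤΣ.sum-cong-≗ (λ i → ℤP.*-distribʳ-+ (ρ n (toℕ i)) (u i) (v i)))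
                    (ℤΣ.∑-distrib-+ (λ i → u i *ᶻ ρ n (toℕ i)) (λ i → v i *ᶻ ρ n (toℕ i)))

col-⊖ : ∀ {t} (u v : Vecℤ t) n → col (u ⊖ v) n ≡ col u n -ᶻ col v n
col-⊖ u v n = trans (ℤΣ.sum-cong-≗ (λ i → distrib (u i) (v i) (ρ n (toℕ i))))
                    (∑-minus (λ i → u i *ᶻ ρ n (toℕ i)) (λ i → v i *ᶻ ρ n (toℕ i)))
  where
  distrib : ∀ a b c → (a -ᶻ b) *ᶻ c ≡ a *ᶻ c -ᶻ b *ᶻ c
  distrib = solve-∀

col-∑ : ∀ {t m} (F : Fin m → Vecℤ t) n → col (λ i → ∑ᶻ (λ k → F k i)) n ≡ ∑ᶻ (λ k → col (F k) n)
col-∑ {t} {m} F n =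
  trans (ℤΣ.sum-cong-≗ (λ i → ℤΣ.*-distribʳ-sum (ρ n (toℕ i)) (λ k → F k i)))
        (ℤΣ.∑-comm {t} {m} (λ i k → F k i *ᶻ ρ n (toℕ i)))

col-ΣV : ∀ {t} (F : ℕ → Vecℤ t) a b n →
         col (ΣV[ a , b ] F) n ≡ ∑ᶻ {suc b ∸ a} (λ k → col (F (a + toℕ k)) n)
col-ΣV F a b n = trans (col-cong n (ΣV-coord F a b)) (col-∑ {m = suc b ∸ a} (λ k → F (a + toℕ k)) n)

∑-zero : ∀ {n} (f : Fin n → ℤ) → (∀ k → f k ≡ + 0) → ∑ᶻ f ≡ + 0
∑-zero {n} f zeros = trans (ℤΣ.sum-cong-≗ zeros) (ℤΣ.sum-replicate-zero n)

∑-pick : ∀ {t} (g : Fin t → ℤ) (i₀ : Fin t) → ∑ᶻ (λ i → + δ (toℕ i) (toℕ i₀) *ᶻ g i) ≡ g i₀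
∑-pick g Fin.zero =
  trans (cong₂ _+ᶻ_ (ℤP.*-identityˡ (g Fin.zero)) (∑-zero (λ i → + 0 *ᶻ g (Fin.suc i)) (λ _ → refl)))
        (ℤP.+-identityʳ (g Fin.zero))
∑-pick g (Fin.suc i₀) = trans (ℤP.+-identityˡ _) (∑-pick (g ∘ Fin.suc) i₀)

col-σ : ∀ {t m} n → m < t → col {t} (σ (suc m)) n ≡ ρ n m
col-σ {t} {m} n m<t = begin
  col {t} (σ (suc m)) n                                 ≡⟨ ℤΣ.sum-cong-≗ {t} as-delta ⟩
  ∑ᶻ {t} (λ i → + δ (toℕ i) (toℕ i₀) *ᶻ ρ n (toℕ i))   ≡⟨ ∑-pick (λ i → ρ n (toℕ i)) i₀ ⟩
  ρ n (toℕ i₀)                                          ≡⟨ cong (ρ n) i₀≡m ⟩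
  ρ n m                                                 ∎
  where
  open ≡-Reasoning
  i₀ : Fin t
  i₀ = Fin.fromℕ< m<t
  i₀≡m : toℕ i₀ ≡ m
  i₀≡m = FinP.toℕ-fromℕ< m<t
  as-delta : ∀ i → σ (suc m) i *ᶻ ρ n (toℕ i) ≡ + δ (toℕ i) (toℕ i₀) *ᶻ ρ n (toℕ i)
  as-delta i = cong (_*ᶻ ρ n (toℕ i)) (trans (σ-δ (suc m) i) (cong (λ x → + δ (toℕ i) x) (sym i₀≡m)))

col-σ-beyond : ∀ {t s} n → t < s → col {t} (σ s) n ≡ + 0
col-σ-beyond {t} {s} n t<s = ∑-zero _ (λ i → cong (_*ᶻ ρ n (toℕ i))
  (trans (σ-δ s i) (cong +_ (δ-≢ (λ idx≡s → ℕP.<⇒≱ t<s (subst (_≤ t) idx≡s (FinP.toℕ<n i)))))))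

-- Passing from coordinate m to m+1 flips exactly the row R^m from -1 to +1.
ρ-step : ∀ m s → ρ m s ≡ ρ (suc m) s -ᶻ (+ δ s m +ᶻ + δ s m)
ρ-step m s with ℕP.<-cmp s m
... | tri< s<m _ _ rewrite ρ-> s<m | ρ-> (ℕP.m<n⇒m<1+n s<m) | δ-≢ (ℕP.<⇒≢ s<m) = refl
... | tri≈ _ refl _ rewrite ρ-≤ (ℕP.≤-refl {s}) | ρ-> (ℕP.n<1+n s) | δ-refl s = refl
... | tri> _ _ m<s rewrite ρ-≤ (ℕP.<⇒≤ m<s) | ρ-≤ m<s | δ-≢ (ℕP.>⇒≢ m<s) = refl

col-step : ∀ {t} (w : Vecℤ t) (i₀ : Fin t) →
           col w (toℕ i₀) ≡ col w (suc (toℕ i₀)) -ᶻ (w i₀ +ᶻ w i₀)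
col-step {t} w i₀ = begin
  col w m
    ≡⟨ ℤΣ.sum-cong-≗ {t} (λ i → trans (cong (w i *ᶻ_) (ρ-step m (toℕ i))) (split (w i) _ (d i))) ⟩
  ∑ᶻ {t} (λ i → w i *ᶻ ρ (suc m) (toℕ i) -ᶻ (d i *ᶻ w i +ᶻ d i *ᶻ w i))
    ≡⟨ ∑-minus (λ i → w i *ᶻ ρ (suc m) (toℕ i)) (λ i → d i *ᶻ w i +ᶻ d i *ᶻ w i) ⟩
  col w (suc m) -ᶻ ∑ᶻ {t} (λ i → d i *ᶻ w i +ᶻ d i *ᶻ w i)
    ≡⟨ cong (col w (suc m) -ᶻ_) (ℤΣ.∑-distrib-+ (λ i → d i *ᶻ w i) (λ i → d i *ᶻ w i)) ⟩
  col w (suc m) -ᶻ (∑ᶻ {t} (λ i → d i *ᶻ w i) +ᶻ ∑ᶻ {t} (λ i → d i *ᶻ w i))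
    ≡⟨ cong (λ x → col w (suc m) -ᶻ (x +ᶻ x)) (∑-pick w i₀) ⟩
  col w (suc m) -ᶻ (w i₀ +ᶻ w i₀)                       ∎
  where
  open ≡-Reasoning
  m = toℕ i₀
  d : Fin t → ℤ
  d i = + δ (toℕ i) m
  split : ∀ a r c → a *ᶻ (r -ᶻ (c +ᶻ c)) ≡ a *ᶻ r -ᶻ (c *ᶻ a +ᶻ c *ᶻ a)
  split = solve-∀

-- Coordinate 0 sees every row as -1 and coordinate t sees every row as +1.
col-wrap : ∀ {t} (w : Vecℤ t) → col w 0 ≡ - col w t
col-wrap {t} w = begin
  col w 0                                              ≡⟨ ℤΣ.sum-cong-≗ {t} negate ⟩
  ∑ᶻ {t} (λ i → - (+ 1) *ᶻ (w i *ᶻ ρ t (toℕ i)))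
    ≡⟨ sym (ℤΣ.*-distribˡ-sum (- (+ 1)) (λ i → w i *ᶻ ρ t (toℕ i))) ⟩
  - (+ 1) *ᶻ col w t                                   ≡⟨ ℤP.-1*i≡-i (col w t) ⟩
  - col w t                                            ∎
  where
  open ≡-Reasoning
  flip : ∀ a → a *ᶻ - (+ 1) ≡ - (+ 1) *ᶻ (a *ᶻ + 1)
  flip = solve-∀
  negate : ∀ i → w i *ᶻ ρ 0 (toℕ i) ≡ - (+ 1) *ᶻ (w i *ᶻ ρ t (toℕ i))
  negate i rewrite ρ-≤ {0} {toℕ i} z≤n | ρ-> (FinP.toℕ<n i) = flip (w i)

double-zero : ∀ a → + 0 ≡ + 0 -ᶻ (a +ᶻ a) → a ≡ + 0
double-zero (+ 0)       _ = refl
double-zero ℤ.+[1+ n ] ()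
double-zero ℤ.-[1+ n ] ()

col-injective : ∀ {t} (w : Vecℤ t) → (∀ (e : Fin t) → col w (idx e) ≡ + 0) → ∀ i → w i ≡ + 0
col-injective {zero} _ _ ()
col-injective {suc t} w vanish i₀ = double-zero (w i₀) (begin
  + 0                                       ≡⟨ sym (vanish-≤ (toℕ i₀) (ℕP.<⇒≤ (FinP.toℕ<n i₀))) ⟩
  col w (toℕ i₀)                            ≡⟨ col-step w i₀ ⟩
  col w (suc (toℕ i₀)) -ᶻ (w i₀ +ᶻ w i₀)
    ≡⟨ cong (_-ᶻ (w i₀ +ᶻ w i₀)) (vanish-< (toℕ i₀) (FinP.toℕ<n i₀)) ⟩
  + 0 -ᶻ (w i₀ +ᶻ w i₀)                     ∎)
  where
  open ≡-Reasoning
  vanish-< : ∀ m → m < suc t → col w (suc m) ≡ + 0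
  vanish-< m m<t = subst (λ x → col w (suc x) ≡ + 0) (FinP.toℕ-fromℕ< m<t) (vanish (Fin.fromℕ< m<t))
  vanish-≤ : ∀ m → m ≤ suc t → col w m ≡ + 0
  vanish-≤ zero    _   = trans (col-wrap w) (cong -_ (vanish-< t ℕP.≤-refl))
  vanish-≤ (suc m) m<t = vanish-< m m<t

solution-unique : ∀ {t} {u v T : Vecℤ t} → xM u ≗v T → xM v ≗v T → u ≗v v
solution-unique {t} {u} {v} {T} uM vM i =
  ℤP.i-j≡0⇒i≡j (u i) (v i) (col-injective (u ⊖ v) difference i)
  where
  difference : ∀ (e : Fin t) → col (u ⊖ v) (idx e) ≡ + 0
  difference e = begin
    col (u ⊖ v) (idx e)               ≡⟨ col-⊖ u v (idx e) ⟩
    col u (idx e) -ᶻ col v (idx e)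
      ≡⟨ cong₂ _-ᶻ_ (trans (sym (xM-col u e)) (uM e)) (trans (sym (xM-col v e)) (vM e)) ⟩
    T e -ᶻ T e                        ≡⟨ ℤP.+-inverseʳ (T e) ⟩
    + 0                               ∎
    where open ≡-Reasoning

isX : ∀ {t} {T v : Vecℤ t} → (∀ e → col v (idx e) ≡ T e) → IsXOf T v
isX {v = v} vM = vM′ , λ y yM → solution-unique yM vM′
  where vM′ = λ e → trans (xM-col v e) (vM e)

inside : ℕ → ℕ → ℕ → ℕ
inside a b n = 𝟙 (does (a ≤? n ×-dec n ≤? b))

inside-∈ : ∀ {a b n} → a ≤ n → n ≤ b → inside a b n ≡ 1
inside-∈ {a} {b} {n} a≤n n≤b rewrite dec-true (a ≤? n ×-dec n ≤? b) (a≤n , n≤b) = refl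

inside-below : ∀ {a b n} → n < a → inside a b n ≡ 0
inside-below {a} {b} {n} n<a rewrite dec-false (a ≤? n ×-dec n ≤? b) (ℕP.<⇒≱ n<a ∘ proj₁) = refl

inside-above : ∀ {a b n} → b < n → inside a b n ≡ 0
inside-above {a} {b} {n} b<n rewrite dec-false (a ≤? n ×-dec n ≤? b) (ℕP.<⇒≱ b<n ∘ proj₂) = refl

interval-value : ∀ {t a b n} → 1 ≤ a → a ≤ b → b ≤ t → n ≤ t →
                 col {t} (σ (suc b)) n -ᶻ col {t} (σ a) n ≡ + δ b t -ᶻ (+ inside a b n +ᶻ + inside a b n)
interval-value {t} {suc a} {b} {n} _ a<b b≤t n≤t
  rewrite col-σ {t} n (ℕP.<-≤-trans a<b b≤t) with ℕP.m≤n⇒m<n∨m≡n b≤t | suc a ≤? n | n ≤? b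
... | inj₁ b<t | no a≮n | _
  rewrite col-σ {t} n b<t | δ-≢ (ℕP.<⇒≢ b<t) | inside-below {b = b} (ℕP.≰⇒> a≮n)
        | ρ-≤ (ℕP.≤-pred (ℕP.≰⇒> a≮n))
        | ρ-≤ (ℕP.≤-trans (ℕP.≤-pred (ℕP.≰⇒> a≮n)) (ℕP.<⇒≤ a<b)) = refl
... | inj₁ b<t | yes a<n | yes n≤b
  rewrite col-σ {t} n b<t | δ-≢ (ℕP.<⇒≢ b<t) | inside-∈ a<n n≤b | ρ-> a<n | ρ-≤ n≤b = refl
... | inj₁ b<t | yes a<n | no n≰b
  rewrite col-σ {t} n b<t | δ-≢ (ℕP.<⇒≢ b<t) | inside-above {suc a} (ℕP.≰⇒> n≰b)
        | ρ-> a<n | ρ-> (ℕP.≰⇒> n≰b) = refl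
... | inj₂ refl | no a≮n | _
  rewrite col-σ-beyond {t} n (ℕP.n<1+n t) | δ-refl t | inside-below {b = t} (ℕP.≰⇒> a≮n)
        | ρ-≤ (ℕP.≤-pred (ℕP.≰⇒> a≮n)) = refl
... | inj₂ refl | yes a<n | _
  rewrite col-σ-beyond {t} n (ℕP.n<1+n t) | δ-refl t | inside-∈ a<n n≤t | ρ-> a<n = refl

ordered-unique : ∀ {n} {P : Pred (Fin n) 0ℓ} → (∀ {k l} → k Fin.< l → P k → P l → ⊥) → AtMostOne P
ordered-unique no-pair {k} {l} pk pl with FinP.<-cmp k l
... | tri< k<l _ _ = ⊥-elim (no-pair k<l pk pl)
... | tri≈ _ k≡l _ = k≡l
... | tri> _ _ l<k = ⊥-elim (no-pair l<k pl pk)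

lookup-∈ₙ : ∀ {t} (A : Subset t) (e : Fin t) → lookup A e ≡ true → idx e ∈ₙ A
lookup-∈ₙ A e e∈A = e , refl , VecP.lookup⇒[]= e A e∈A

∈ₙ-lookup : ∀ {t} (A : Subset t) (e : Fin t) → idx e ∈ₙ A → lookup A e ≡ true
∈ₙ-lookup A e (e′ , idx≡ , e′∈A) =
  subst (λ x → lookup A x ≡ true) (FinP.toℕ-injective (ℕP.suc-injective idx≡)) (VecP.[]=⇒lookup e′∈A)

record Blocks (t : ℕ) (A : Subset t) {ϱ : ℕ} (lo hi : Fin ϱ → ℕ) : Set where
  field
    lo-pos    : ∀ k → 1 ≤ lo k
    lo≤hi     : ∀ k → lo k ≤ hi k
    hi≤t      : ∀ k → hi k ≤ t
    separated : ∀ {k l} → k Fin.< l → suc (hi k) < lo l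
    covers    : ∀ n → n ∈ₙ A ⇔ ∃ λ k → lo k ≤ n × n ≤ hi k

module BlockFacts {t ϱ} {A : Subset t} {lo hi : Fin ϱ → ℕ} (B : Blocks t A lo hi) where
  open Blocks B

  hi<lo : ∀ {k l} → k Fin.< l → hi k < lo l
  hi<lo k<l = ℕP.<-trans (ℕP.n<1+n _) (separated k<l)

  lo<lo : ∀ {k l} → k Fin.< l → lo k < lo l
  lo<lo {k} k<l = ℕP.≤-<-trans (lo≤hi k) (hi<lo k<l)

  lo-mono : ∀ {k l} → k Fin.≤ l → lo k ≤ lo l
  lo-mono {k} {l} k≤l with ℕP.m≤n⇒m<n∨m≡n k≤l
  ... | inj₁ k<l = ℕP.<⇒≤ (lo<lo k<l)
  ... | inj₂ k≡l = ℕP.≤-reflexive (cong lo (FinP.toℕ-injective k≡l))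

  lo-injective : Injective _≡_ _≡_ lo
  lo-injective {k} {l} lo≡ = ordered-unique {P = λ x → lo x ≡ lo l}
    (λ x<y lox lay → ℕP.<-irrefl (trans lox (sym lay)) (lo<lo x<y)) lo≡ refl

  hi-injective : Injective _≡_ _≡_ hi
  hi-injective {k} {l} hi≡ = ordered-unique {P = λ x → hi x ≡ hi l}
    (λ {_} {y} x<y hix hiy → ℕP.<-irrefl (trans hix (sym hiy)) (ℕP.<-≤-trans (hi<lo x<y) (lo≤hi y))) hi≡ refl

  hi+1≢lo : ∀ k l → suc (hi k) ≢ lo l
  hi+1≢lo k l eq with FinP.<-cmp k l
  ... | tri< k<l _ _ = ℕP.<-irrefl eq (separated k<l)
  ... | tri≈ _ refl _ = ℕP.<-irrefl (sym eq) (s≤s (lo≤hi k))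
  ... | tri> _ _ l<k = ℕP.<-irrefl (sym eq) (ℕP.<-trans (lo<lo l<k) (s≤s (lo≤hi k)))

  InBlock : ℕ → Pred (Fin ϱ) 0ℓ
  InBlock n k = lo k ≤ n × n ≤ hi k

  inBlock? : ∀ n → Decidable (InBlock n)
  inBlock? n k = lo k ≤? n ×-dec n ≤? hi k

  endsAt? : ∀ m → Decidable (λ k → hi k ≡ m)
  endsAt? m k = hi k ℕ.≟ m

  blocks-disjoint : ∀ n → AtMostOne (InBlock n)
  blocks-disjoint n = ordered-unique
    (λ k<l (_ , n≤hi) (lo≤n , _) →
       ℕP.<-irrefl refl (ℕP.≤-<-trans lo≤n (ℕP.≤-<-trans n≤hi (hi<lo k<l))))

  count-inBlock-∈ : ∀ {n} → n ∈ₙ A → count (inBlock? n) ≡ 1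
  count-inBlock-∈ {n} n∈A with Equivalence.to (covers n) n∈A
  ... | k , in-k = count-one (inBlock? n) in-k (blocks-disjoint n)

  count-inBlock-∉ : ∀ {n} → ¬ (n ∈ₙ A) → count (inBlock? n) ≡ 0
  count-inBlock-∉ {n} n∉A = count-none (inBlock? n) (λ k in-k → n∉A (Equivalence.from (covers n) (k , in-k)))

  count-endsAt-∈ : t ∈ₙ A → count (endsAt? t) ≡ 1
  count-endsAt-∈ t∈A with Equivalence.to (covers t) t∈A
  ... | k , _ , t≤hi = count-one (endsAt? t) (ℕP.≤-antisym (hi≤t k) t≤hi)
                                  (λ hik hil → hi-injective (trans hik (sym hil)))

  ends-at⇒∈ : ∀ {m} k → hi k ≡ m → m ∈ₙ A
  ends-at⇒∈ {m} k hi≡m =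
    Equivalence.from (covers m) (k , subst (lo k ≤_) hi≡m (lo≤hi k) , ℕP.≤-reflexive (sym hi≡m))

  count-endsAt-∉ : ¬ (t ∈ₙ A) → count (endsAt? t) ≡ 0
  count-endsAt-∉ t∉A = count-none (endsAt? t) (λ k → t∉A ∘ ends-at⇒∈ k)

  lo≢1 : ¬ (1 ∈ₙ A) → ∀ k → lo k ≢ 1
  lo≢1 1∉A k lo≡1 =
    1∉A (Equivalence.from (covers 1) (k , ℕP.≤-reflexive lo≡1 , subst (_≤ hi k) lo≡1 (lo≤hi k)))

  hi<t : ¬ (t ∈ₙ A) → ∀ k → hi k < t
  hi<t t∉A k = ℕP.≤∧≢⇒< (hi≤t k) (t∉A ∘ ends-at⇒∈ k)

  lo-range : InRange t lo
  lo-range k = lo-pos k , ℕP.≤-trans (lo≤hi k) (hi≤t k)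

  hi<t-before : ∀ {k l} → k Fin.< l → hi k < t
  hi<t-before {l = l} k<l = ℕP.<-≤-trans (hi<lo k<l) (ℕP.≤-trans (lo≤hi l) (hi≤t l))

  last-hi : ∀ {l} → (∀ k → k Fin.≤ l) → t ∈ₙ A → hi l ≡ t
  last-hi {l} last t∈A with Equivalence.to (covers t) t∈A
  ... | k , _ , t≤hi with ℕP.m≤n⇒m<n∨m≡n (last k)
  ...   | inj₁ k<l = ⊥-elim (ℕP.<⇒≱ (hi<t-before k<l) t≤hi)
  ...   | inj₂ k≡l = subst (λ x → hi x ≡ t) (FinP.toℕ-injective k≡l) (ℕP.≤-antisym (hi≤t k) t≤hi)

  first-lo : ∀ {f} → (∀ k → f Fin.≤ k) → 1 ∈ₙ A → lo f ≡ 1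
  first-lo {f} first 1∈A with Equivalence.to (covers 1) 1∈A
  ... | k , lo≤1 , _ = ℕP.≤-antisym (ℕP.≤-trans (lo-mono (first k)) lo≤1) (lo-pos f)

  blockImage : Fin ϱ → ℕ → ℤ
  blockImage k n = col {t} (σ (suc (hi k))) n -ᶻ col {t} (σ (lo k)) n

  blocks-value : ∀ {n} → n ≤ t →
    ∑ᶻ (λ k → blockImage k n)
      ≡ + count (endsAt? t) -ᶻ (+ count (inBlock? n) +ᶻ + count (inBlock? n))
  blocks-value {n} n≤t = begin
    ∑ᶻ (λ k → blockImage k n)
      ≡⟨ ℤΣ.sum-cong-≗ (λ k → interval-value (lo-pos k) (lo≤hi k) (hi≤t k) n≤t) ⟩
    ∑ᶻ (λ k → + δ (hi k) t -ᶻ (+ c k +ᶻ + c k))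
      ≡⟨ ∑-minus (λ k → + δ (hi k) t) (λ k → + c k +ᶻ + c k) ⟩
    ∑ᶻ (λ k → + δ (hi k) t) -ᶻ ∑ᶻ (λ k → + c k +ᶻ + c k)
      ≡⟨ cong (∑ᶻ (λ k → + δ (hi k) t) -ᶻ_) (ℤΣ.∑-distrib-+ (λ k → + c k) (λ k → + c k)) ⟩
    ∑ᶻ (λ k → + δ (hi k) t) -ᶻ (∑ᶻ (λ k → + c k) +ᶻ ∑ᶻ (λ k → + c k))
      ≡⟨ sym (cong₂ (λ x y → x -ᶻ (y +ᶻ y)) (∑-pos (λ k → δ (hi k) t)) (∑-pos c)) ⟩
    + count (endsAt? t) -ᶻ (+ count (inBlock? n) +ᶻ + count (inBlock? n)) ∎
    where
    open ≡-Reasoning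
    c : Fin ϱ → ℕ
    c k = inside (lo k) (hi k) n

  target-value : ∀ e → flipA A (T⁺ t) e ≡ + 1 -ᶻ (+ count (inBlock? (idx e)) +ᶻ + count (inBlock? (idx e)))
  target-value e with lookup A e in e∈?A
  ... | true  rewrite count-inBlock-∈ (lookup-∈ₙ A e e∈?A) = refl
  ... | false rewrite count-inBlock-∉ (λ idx∈A → case trans (sym (∈ₙ-lookup A e idx∈A)) e∈?A of λ ()) =
    refl

  hits-target : ∀ (e : Fin t) c₀ → c₀ +ᶻ + count (endsAt? t) ≡ + 1 →
    c₀ +ᶻ ∑ᶻ (λ k → blockImage k (idx e)) ≡ flipA A (T⁺ t) e
  hits-target e c₀ c₀+cT≡1 = begin
    c₀ +ᶻ ∑ᶻ (λ k → blockImage k (idx e))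
      ≡⟨ cong (c₀ +ᶻ_) (blocks-value (FinP.toℕ<n e)) ⟩
    c₀ +ᶻ (+ count (endsAt? t) -ᶻ (+ cA +ᶻ + cA))  ≡⟨ sym (ℤP.+-assoc c₀ _ _) ⟩
    (c₀ +ᶻ + count (endsAt? t)) -ᶻ (+ cA +ᶻ + cA)  ≡⟨ cong (_-ᶻ (+ cA +ᶻ + cA)) c₀+cT≡1 ⟩
    + 1 -ᶻ (+ cA +ᶻ + cA)                          ≡⟨ sym (target-value e) ⟩
    flipA A (T⁺ t) e                               ∎
    where
    open ≡-Reasoning
    cA = count (inBlock? (idx e))

gap-chain : ∀ {t A ϱ} {i j : ℕ → ℕ} → IntervalPartition t A ϱ i j →
            ∀ {k m} → 1 ≤ k → k < m → m ≤ ϱ → j k + 2 ≤ i m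
gap-chain {j = j} P {k} {suc m} 1≤k k<1+m 1+m≤ϱ with ℕP.m≤n⇒m<n∨m≡n (ℕP.≤-pred k<1+m)
... | inj₂ refl = proj₁ (proj₂ P) k 1≤k 1+m≤ϱ
... | inj₁ k<m  = ℕP.≤-trans (gap-chain P 1≤k k<m (ℕP.<⇒≤ 1+m≤ϱ))
    (ℕP.≤-trans (proj₁ (proj₂ (proj₁ P m 1≤m (ℕP.<⇒≤ 1+m≤ϱ))))
      (ℕP.≤-trans (ℕP.m≤m+n (j m) 2) (proj₁ (proj₂ P) m 1≤m 1+m≤ϱ)))
  where 1≤m = ℕP.≤-trans 1≤k (ℕP.<⇒≤ k<m)

partition-nonempty : ∀ {t A ϱ i j} → IntervalPartition t A ϱ i j → ∃ (λ n → n ∈ₙ A) → 1 ≤ ϱ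
partition-nonempty P (n , n∈A) with Equivalence.to (proj₂ (proj₂ P) n) n∈A
... | k , 1≤k , k≤ϱ , _ = ℕP.≤-trans 1≤k k≤ϱ

partition-blocks : ∀ {t A r i j} → IntervalPartition t A (suc r) i j →
                   Blocks t A (λ k → i (suc (toℕ k))) (λ k → j (suc (toℕ k)))
partition-blocks {t} {A} {r} {i} {j} P@(bounds , _ , members) = record
  { lo-pos    = λ k → proj₁ (bounds-of k)
  ; lo≤hi     = λ k → proj₁ (proj₂ (bounds-of k))
  ; hi≤t      = λ k → proj₂ (proj₂ (bounds-of k))
  ; separated = λ {k} {l} k<l → subst (_≤ i (suc (toℕ l))) (ℕP.+-comm (j (suc (toℕ k))) 2)
                                  (gap-chain P (s≤s z≤n) (s≤s k<l) (FinP.toℕ<n _))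
  ; covers    = λ n → mk⇔ (to n) (from n)
  }
  where
  bounds-of : ∀ (k : Fin (suc r)) →
              1 ≤ i (suc (toℕ k)) × i (suc (toℕ k)) ≤ j (suc (toℕ k)) × j (suc (toℕ k)) ≤ t
  bounds-of k = bounds (suc (toℕ k)) (s≤s z≤n) (FinP.toℕ<n k)
  to : ∀ n → n ∈ₙ A → ∃ λ (k : Fin (suc r)) → i (suc (toℕ k)) ≤ n × n ≤ j (suc (toℕ k))
  to n n∈A with Equivalence.to (members n) n∈A
  ... | suc k , _ , k<1+r , in-k =
    Fin.fromℕ< k<1+r , subst (λ x → i (suc x) ≤ n × n ≤ j (suc x)) (sym (FinP.toℕ-fromℕ< k<1+r)) in-k
  from : ∀ n → (∃ λ (k : Fin (suc r)) → i (suc (toℕ k)) ≤ n × n ≤ j (suc (toℕ k))) → n ∈ₙ A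
  from n (k , in-k) = Equivalence.from (members n) (suc (toℕ k) , s≤s z≤n , FinP.toℕ<n k , in-k)

∷-injective : ∀ {n} {x} {f : Fin n → ℕ} → (∀ k → f k ≢ x) → Injective _≡_ _≡_ f →
              Injective _≡_ _≡_ (x VecF.∷ f)
∷-injective f≢x f-inj {Fin.zero}  {Fin.zero}  _  = refl
∷-injective f≢x f-inj {Fin.zero}  {Fin.suc l} eq = ⊥-elim (f≢x l (sym eq))
∷-injective f≢x f-inj {Fin.suc k} {Fin.zero}  eq = ⊥-elim (f≢x k eq)
∷-injective f≢x f-inj {Fin.suc k} {Fin.suc l} eq = cong Fin.suc (f-inj eq)

coordinate⇒0<t : ∀ {t} → Fin t → 0 < t
coordinate⇒0<t e = ℕP.≤-trans (s≤s z≤n) (FinP.toℕ<n e)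

col-σ1 : ∀ {t n} → 0 < t → 1 ≤ n → col {t} (σ 1) n ≡ + 1
col-σ1 {n = n} 0<t 1≤n = trans (col-σ n 0<t) (ρ-> 1≤n)

size-ii : ∀ r → r + suc r ≡ 2 * suc r ∸ 1
size-ii r = cong (λ x → r + suc x) (sym (ℕP.+-identityʳ r))

size-i : ∀ r → suc r + r ≡ 2 * suc r ∸ 1
size-i r = trans (ℕP.+-comm (suc r) r) (size-ii r)

size-iii : ∀ r → suc (suc r) + suc r ≡ 2 * suc r + 1
size-iii = NatSolver.solve-∀

module Cases {t r} {A : Subset t} {i j : ℕ → ℕ} (P : IntervalPartition t A (suc r) i j) where

  lo hi : Fin (suc r) → ℕ
  lo k = i (suc (toℕ k))
  hi k = j (suc (toℕ k))

  B : Blocks t A lo hi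
  B = partition-blocks P

  open Blocks B
  open BlockFacts B

  ends ends-init starts starts-tail : Vecℤ t
  ends        = ΣV[ 1 , suc r ] (λ k → σ (suc (j k)))
  ends-init   = ΣV[ 1 , suc r ∸ 1 ] (λ k → σ (suc (j k)))
  starts      = ΣV[ 1 , suc r ] (λ l → σ (i l))
  starts-tail = ΣV[ 2 , suc r ] (λ l → σ (i l))

  endImg startImg : Fin (suc r) → ℕ → ℤ
  endImg k n   = col {t} (σ (suc (hi k))) n
  startImg k n = col {t} (σ (lo k)) n

  ends-image : ∀ n → col ends n ≡ ∑ᶻ (λ k → endImg k n)
  ends-image = col-ΣV {t} (λ k → σ (suc (j k))) 1 (suc r)

  starts-image : ∀ n → col starts n ≡ ∑ᶻ (λ k → startImg k n)
  starts-image = col-ΣV {t} (λ l → σ (i l)) 1 (suc r)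

  starts-tail-image : ∀ n → col starts-tail n ≡ ∑ᶻ (λ k → startImg (Fin.suc k) n)
  starts-tail-image = col-ΣV {t} (λ l → σ (i l)) 2 (suc r)

  ends-init-image : ∀ n → col ends-init n ≡ ∑ᶻ (λ k → endImg (Fin.inject₁ k) n)
  ends-init-image n = trans (col-ΣV {t} (λ k → σ (suc (j k))) 1 r n)
    (ℤΣ.sum-cong-≗ {r} (λ k → cong (λ x → col {t} (σ (suc (j (suc x)))) n) (sym (FinP.toℕ-inject₁ k))))

  image-i : ∀ n → col (ends ⊖ starts-tail) n ≡ startImg Fin.zero n +ᶻ ∑ᶻ (λ k → blockImage k n)
  image-i n = begin
    col (ends ⊖ starts-tail) n        ≡⟨ col-⊖ ends starts-tail n ⟩
    col ends n -ᶻ col starts-tail n   ≡⟨ cong₂ _-ᶻ_ (ends-image n) (starts-tail-image n) ⟩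
    E -ᶻ S′                           ≡⟨ regroup E S′ s₀ ⟩
    s₀ +ᶻ (E -ᶻ (s₀ +ᶻ S′))
      ≡⟨ cong (s₀ +ᶻ_) (sym (∑-minus (λ k → endImg k n) (λ k → startImg k n))) ⟩
    s₀ +ᶻ ∑ᶻ (λ k → blockImage k n)   ∎
    where
    open ≡-Reasoning
    E S′ s₀ : ℤ
    E  = ∑ᶻ (λ k → endImg k n)
    S′ = ∑ᶻ (λ k → startImg (Fin.suc k) n)
    s₀ = startImg Fin.zero n
    regroup : ∀ a b c → a -ᶻ b ≡ c +ᶻ (a -ᶻ (c +ᶻ b))
    regroup = solve-∀

  image-iii : ∀ n → col ((σ 1 ⊕ ends) ⊖ starts) n ≡ col {t} (σ 1) n +ᶻ ∑ᶻ (λ k → blockImage k n)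
  image-iii n = begin
    col ((σ 1 ⊕ ends) ⊖ starts) n                   ≡⟨ col-⊖ (σ 1 ⊕ ends) starts n ⟩
    col (σ 1 ⊕ ends) n -ᶻ col starts n
      ≡⟨ cong (_-ᶻ col starts n) (col-⊕ (σ 1) ends n) ⟩
    (c₁ +ᶻ col ends n) -ᶻ col starts n
      ≡⟨ cong₂ (λ x y → (c₁ +ᶻ x) -ᶻ y) (ends-image n) (starts-image n) ⟩
    (c₁ +ᶻ E) -ᶻ S                                  ≡⟨ ℤP.+-assoc c₁ E (- S) ⟩
    c₁ +ᶻ (E -ᶻ S)
      ≡⟨ cong (c₁ +ᶻ_) (sym (∑-minus (λ k → endImg k n) (λ k → startImg k n))) ⟩
    c₁ +ᶻ ∑ᶻ (λ k → blockImage k n)                 ∎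
    where
    open ≡-Reasoning
    c₁ E S : ℤ
    c₁ = col {t} (σ 1) n
    E = ∑ᶻ (λ k → endImg k n)
    S = ∑ᶻ (λ k → startImg k n)

  image-ii : ∀ n → col (ends-init ⊖ starts) n ≡ ∑ᶻ (λ k → blockImage k n) -ᶻ endImg (Fin.fromℕ r) n
  image-ii n = begin
    col (ends-init ⊖ starts) n          ≡⟨ col-⊖ ends-init starts n ⟩
    col ends-init n -ᶻ col starts n     ≡⟨ cong₂ _-ᶻ_ (ends-init-image n) (starts-image n) ⟩
    E′ -ᶻ S                             ≡⟨ regroup E′ S eₗ ⟩
    ((E′ +ᶻ eₗ) -ᶻ S) -ᶻ eₗ
      ≡⟨ cong (λ x → (x -ᶻ S) -ᶻ eₗ) (sym (ℤΣ.sum-init-last (λ k → endImg k n))) ⟩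
    (E -ᶻ S) -ᶻ eₗ
      ≡⟨ cong (_-ᶻ eₗ) (sym (∑-minus (λ k → endImg k n) (λ k → startImg k n))) ⟩
    ∑ᶻ (λ k → blockImage k n) -ᶻ eₗ     ∎
    where
    open ≡-Reasoning
    E E′ S eₗ : ℤ
    E  = ∑ᶻ (λ k → endImg k n)
    E′ = ∑ᶻ (λ k → endImg (Fin.inject₁ k) n)
    S  = ∑ᶻ (λ k → startImg k n)
    eₗ = endImg (Fin.fromℕ r) n
    regroup : ∀ a b c → a -ᶻ b ≡ ((a +ᶻ c) -ᶻ b) -ᶻ c
    regroup = solve-∀

  case-i : 1 ∈ₙ A → ¬ (t ∈ₙ A) →
           (nnz (ends ⊖ starts-tail) ≡ 2 * suc r ∸ 1) × IsXOf (flipA A (T⁺ t)) (ends ⊖ starts-tail)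
  case-i 1∈A t∉A =
    support , isX (λ e → trans (image-i (idx e)) (hits-target e (startImg Fin.zero (idx e)) (correction e)))
    where
    correction : ∀ (e : Fin t) → startImg Fin.zero (idx e) +ᶻ + count (endsAt? t) ≡ + 1
    correction e rewrite first-lo (λ _ → z≤n) 1∈A | count-endsAt-∉ t∉A =
      trans (ℤP.+-identityʳ _) (col-σ1 (coordinate⇒0<t e) (s≤s z≤n))
    support : nnz (ends ⊖ starts-tail) ≡ 2 * suc r ∸ 1
    support = trans (nnz-cong {t} (λ e → cong₂ _-ᶻ_ (ΣV-coord (λ k → σ (suc (j k))) 1 (suc r) e)
                                                (ΣV-coord (λ l → σ (i l)) 2 (suc r) e)))
      (trans (nnz-signed {t} (suc ∘ hi) (lo ∘ Fin.suc)
                (hi-injective ∘ ℕP.suc-injective) (FinP.suc-injective ∘ lo-injective)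
                (λ k l → hi+1≢lo k (Fin.suc l)) (λ k → s≤s z≤n , hi<t t∉A k) (lo-range ∘ Fin.suc))
             (size-i r))

  case-ii : t ∈ₙ A →
            (nnz (ends-init ⊖ starts) ≡ 2 * suc r ∸ 1) × IsXOf (flipA A (T⁺ t)) (ends-init ⊖ starts)
  case-ii t∈A =
    support , isX (λ e → trans (image-ii (idx e)) (trans (drop-last e) (hits-target e (+ 0) correction)))
    where
    drop-last : ∀ (e : Fin t) → ∑ᶻ (λ k → blockImage k (idx e)) -ᶻ endImg (Fin.fromℕ r) (idx e)
                                ≡ + 0 +ᶻ ∑ᶻ (λ k → blockImage k (idx e))
    drop-last e rewrite last-hi FinP.≤fromℕ t∈A | col-σ-beyond {t} (idx e) (ℕP.n<1+n t) =
      trans (ℤP.+-identityʳ (∑ᶻ (λ k → blockImage k (idx e)))) (sym (ℤP.+-identityˡ _))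
    correction : + 0 +ᶻ + count (endsAt? t) ≡ + 1
    correction = cong +_ (count-endsAt-∈ t∈A)
    before-last : ∀ k → Fin.inject₁ k Fin.< Fin.fromℕ r
    before-last k = subst (toℕ (Fin.inject₁ k) <_) (sym (FinP.toℕ-fromℕ r)) (FinP.inject₁ℕ< k)
    support : nnz (ends-init ⊖ starts) ≡ 2 * suc r ∸ 1
    support = trans (nnz-cong {t} (λ e → cong₂ _-ᶻ_
        (trans (ΣV-coord (λ k → σ (suc (j k))) 1 r e)
               (ℤΣ.sum-cong-≗ {r} (λ k → cong (λ x → σ (suc (j (suc x))) e) (sym (FinP.toℕ-inject₁ k)))))
        (ΣV-coord (λ l → σ (i l)) 1 (suc r) e)))
      (trans (nnz-signed {t} (suc ∘ hi ∘ Fin.inject₁) lo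
                (FinP.inject₁-injective ∘ hi-injective ∘ ℕP.suc-injective) lo-injective
                (λ k l → hi+1≢lo (Fin.inject₁ k) l) (λ k → s≤s z≤n , hi<t-before (before-last k)) lo-range)
             (size-ii r))

  case-iii : ¬ (1 ∈ₙ A) → ¬ (t ∈ₙ A) →
             (nnz ((σ 1 ⊕ ends) ⊖ starts) ≡ 2 * suc r + 1) × IsXOf (flipA A (T⁺ t)) ((σ 1 ⊕ ends) ⊖ starts)
  case-iii 1∉A t∉A =
    support , isX (λ e → trans (image-iii (idx e)) (hits-target e (col {t} (σ 1) (idx e)) (correction e)))
    where
    correction : ∀ (e : Fin t) → col {t} (σ 1) (idx e) +ᶻ + count (endsAt? t) ≡ + 1
    correction e rewrite count-endsAt-∉ t∉A = trans (ℤP.+-identityʳ _) (col-σ1 (coordinate⇒0<t e) (s≤s z≤n))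
    0<t : 0 < t
    0<t = ℕP.<-≤-trans (lo-pos Fin.zero) (proj₂ (lo-range Fin.zero))
    hi+1≢1 : ∀ k → suc (hi k) ≢ 1
    hi+1≢1 k eq = ℕP.<-irrefl (sym (ℕP.suc-injective eq)) (ℕP.<-≤-trans (lo-pos k) (lo≤hi k))
    ends≢starts : ∀ k l → (1 VecF.∷ (suc ∘ hi)) k ≢ lo l
    ends≢starts Fin.zero    l = lo≢1 1∉A l ∘ sym
    ends≢starts (Fin.suc k) l = hi+1≢lo k l
    support : nnz ((σ 1 ⊕ ends) ⊖ starts) ≡ 2 * suc r + 1
    support = trans (nnz-cong {t} (λ e → cong₂ _-ᶻ_
        (cong (σ 1 e +ᶻ_) (ΣV-coord (λ k → σ (suc (j k))) 1 (suc r) e))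
        (ΣV-coord (λ l → σ (i l)) 1 (suc r) e)))
      (trans (nnz-signed {t} (1 VecF.∷ (suc ∘ hi)) lo
                (∷-injective hi+1≢1 (hi-injective ∘ ℕP.suc-injective)) lo-injective ends≢starts
                (λ { Fin.zero → s≤s z≤n , 0<t ; (Fin.suc k) → s≤s z≤n , hi<t t∉A k }) lo-range)
             (size-iii r))

proposition3 :
    (t : ℕ) → 3 ≤ t → (A : Subset t) → (∃ λ n → n ∈ₙ A) →
    (ϱ : ℕ) → (i j : ℕ → ℕ) → IntervalPartition t A ϱ i j →
      ((1 ∈ₙ A) → ¬ (t ∈ₙ A) →
        (nnz {t} (ΣV[ 1 , ϱ ] (λ k → σ (suc (j k))) ⊖ ΣV[ 2 , ϱ ] (λ l → σ (i l))) ≡ 2 * ϱ ∸ 1)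
        × IsXOf (flipA A (T⁺ t)) (ΣV[ 1 , ϱ ] (λ k → σ (suc (j k))) ⊖ ΣV[ 2 , ϱ ] (λ l → σ (i l))))
      × ((1 ∈ₙ A) → (t ∈ₙ A) →
        (nnz {t} (ΣV[ 1 , ϱ ∸ 1 ] (λ k → σ (suc (j k))) ⊖ ΣV[ 1 , ϱ ] (λ l → σ (i l))) ≡ 2 * ϱ ∸ 1)
        × IsXOf (flipA A (T⁺ t)) (ΣV[ 1 , ϱ ∸ 1 ] (λ k → σ (suc (j k))) ⊖ ΣV[ 1 , ϱ ] (λ l → σ (i l))))
      × (¬ (1 ∈ₙ A) → ¬ (t ∈ₙ A) →
        (nnz {t} ((σ 1 ⊕ ΣV[ 1 , ϱ ] (λ k → σ (suc (j k)))) ⊖ ΣV[ 1 , ϱ ] (λ l → σ (i l))) ≡ 2 * ϱ + 1)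
        × IsXOf (flipA A (T⁺ t)) ((σ 1 ⊕ ΣV[ 1 , ϱ ] (λ k → σ (suc (j k)))) ⊖ ΣV[ 1 , ϱ ] (λ l → σ (i l))))
      × (¬ (1 ∈ₙ A) → (t ∈ₙ A) →
        (nnz {t} (ΣV[ 1 , ϱ ∸ 1 ] (λ k → σ (suc (j k))) ⊖ ΣV[ 1 , ϱ ] (λ l → σ (i l))) ≡ 2 * ϱ ∸ 1)
        × IsXOf (flipA A (T⁺ t)) (ΣV[ 1 , ϱ ∸ 1 ] (λ k → σ (suc (j k))) ⊖ ΣV[ 1 , ϱ ] (λ l → σ (i l))))
proposition3 t _ A nonempty zero i j P with partition-nonempty P nonempty
... | ()
proposition3 t _ A nonempty (suc r) i j P =
    case-i
  , (λ _ t∈A → case-ii t∈A)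
  , case-iii
  , (λ _ t∈A → case-ii t∈A)
  where open Cases P
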